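{- Let $\boldsymbol{k}$ be a field and $\varphi=[0;X,X,X,\ldots]\in\overline{\boldsymbol{k}((X^{ -1}))}$, with associated Fibonacci polynomials $(F_n(X))_{n\ge0}$. For $m\in\mathbb N_0$ let $X^m=\sum_{i=0}^m z_i^{(m)}F_i(X)$ be the $\varphi$-Zeckendorf representation of $X^m$. Then $z_m^{(m)}=1$, $z^{(m)}_{m-2k}=(-1)^k\left(\binom{m}{k}-\binom{m}{k-1}\right)\cdot 1$ for $k=1,\ldots,\lfloor m/2\rfloor$, and all other coefficients $z_i^{(m)}$ are $0$. Consequently, $$\mathcal{U}_\varphi=\left(\mathbf{1}_{2\mathbb N_0}(j-l)\,(-1)^{\frac{j-l}{2}}\left(\binom{j-1}{\frac{j-l}{2}}-\binom{j-1}{\frac{j-l}{2}-1}\right)\cdot 1\right)_{l\ge1,\,j\ge1}.$$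
   Context: The continued fraction $[0;A_1,A_2,\ldots]$ means $\cfrac{1}{A_1+\cfrac{1}{A_2+\cdots}}$ in the Laurent series field $\boldsymbol{k}((X^{ -1}))$. The Fibonacci polynomials for $\varphi$ are $F_{ -1}=0$, $F_0=1$, $F_n(X)=XF_{n-1}(X)+F_{n-2}(X)$; since $\deg F_n=n$ with leading coefficient $1$, every $P\in\boldsymbol{k}[X]$ of degree $r$ is uniquely $\sum_{i=0}^r z_iF_i(X)$ with $z_i\in\boldsymbol{k}$ (the $\varphi$-Zeckendorf representation). $\mathcal{U}_\varphi$ is the $\mathbb N\times\mathbb N$ matrix whose first column is $(1,0,0,\ldots)^T$ and whose $(n+1)$st column is $\mathcal{R}\,\cdot$($n$th column), where $\mathcal{R}$ is the tridiagonal matrix with entries $1$ at positions $(j+1,j)$, $-1$ at positions $(j-1,j)$, and $0$ elsewhere. For an integer $n$, $n\cdot 1$ denotes its image in $\boldsymbol{k}$. Binomial coefficients $\binom{n}{k}$ are $0$ when $k<0$ or $n<k$; $\mathbf{1}_{2\mathbb N_0}(x)=1$ if $x$ is an even nonnegative integer and $0$ otherwise. -}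

module Defs where

open import Level using (Level; suc; _⊔_)
open import Algebra.Bundles using (CommutativeRing)
open import Data.Nat as ℕ using (ℕ; zero; _∸_)
open import Data.Nat.Combinatorics using (_C_)
open import Data.Integer as ℤ using (ℤ; +_; -[1+_])
open import Data.Product using (Σ; _×_)
import Data.Product
open import Relation.Nullary using (¬_)

record Field (c ℓ : Level) : Set (suc (c ⊔ ℓ)) where
  field
    commutativeRing : CommutativeRing c ℓ
  open CommutativeRing commutativeRing public
  field
    1≉0     : ¬ (1# ≈ 0#)
    inverse : ∀ x → ¬ (x ≈ 0#) → Σ Carrier (λ y → x * y ≈ 1#)

module _ {c ℓ : Level} (K : Field c ℓ) where
  open Field K using (Carrier; _≈_; _+_; _*_; -_; _-_; 0#; 1#)

  ℕ·1 : ℕ → Carrier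
  ℕ·1 zero       = 0#
  ℕ·1 (ℕ.suc n)  = 1# + ℕ·1 n

  ℤ·1 : ℤ → Carrier
  ℤ·1 (+ n)      = ℕ·1 n
  ℤ·1 -[1+ n ]   = - ℕ·1 (ℕ.suc n)

  -- Polynomials in k[X] represented by their coefficient sequences ℕ → k
  -- (coefficient of X^d at index d); equality is coefficientwise.
  Poly : Set c
  Poly = ℕ → Carrier

  _≈ₚ_ : Poly → Poly → Set ℓ
  P ≈ₚ Q = ∀ d → P d ≈ Q d

  0ₚ : Poly
  0ₚ _ = 0#

  1ₚ : Poly
  1ₚ zero      = 1#
  1ₚ (ℕ.suc _) = 0#

  _+ₚ_ : Poly → Poly → Poly
  (P +ₚ Q) d = P d + Q d

  _·ₚ_ : Carrier → Poly → Poly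
  (a ·ₚ P) d = a * P d

  Xₚ* : Poly → Poly
  Xₚ* P zero      = 0#
  Xₚ* P (ℕ.suc d) = P d

  Xpow : ℕ → Poly
  Xpow zero      = 1ₚ
  Xpow (ℕ.suc m) = Xₚ* (Xpow m)

  -- Fibonacci polynomials for φ = [0;X,X,...]:
  -- Fpair n = (F_{n-1}, F_n), with F_{-1} = 0, F_0 = 1, F_n = X F_{n-1} + F_{n-2}.
  Fpair : ℕ → Poly × Poly
  Fpair zero      = 0ₚ Data.Product., 1ₚ
  Fpair (ℕ.suc n) = let (A Data.Product., B) = Fpair n in B Data.Product., (Xₚ* B +ₚ A)

  Fib : ℕ → Poly
  Fib n = Data.Product.proj₂ (Fpair n)

  ΣF : ℕ → (ℕ → Carrier) → Poly
  ΣF zero      z = z zero ·ₚ Fib zero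
  ΣF (ℕ.suc m) z = ΣF m z +ₚ (z (ℕ.suc m) ·ₚ Fib (ℕ.suc m))

  -- z_0,...,z_m is the φ-Zeckendorf representation of the polynomial P of degree m
  -- (only the values z 0, ..., z m are used).
  IsZeckRep : ℕ → Poly → (ℕ → Carrier) → Set ℓ
  IsZeckRep m P z = P ≈ₚ ΣF m z

  -- Column vectors ℕ → k, 1-based: entry i stored at index i ∸ 1 (index 0 = row 1).
  -- The tridiagonal matrix 𝓡 (1 at (j+1,j), -1 at (j-1,j)) acting on a column:
  -- (𝓡 v)_i = v_{i-1} - v_{i+1}, with v_0 = 0.
  𝓡 : (ℕ → Carrier) → (ℕ → Carrier)
  𝓡 v zero      = - v 1
  𝓡 v (ℕ.suc i) = v i - v (ℕ.suc (ℕ.suc i))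

  e₁ : ℕ → Carrier
  e₁ zero      = 1#
  e₁ (ℕ.suc _) = 0#

  -- the n-th column (0-based n) of 𝓤_φ
  𝓤col : ℕ → (ℕ → Carrier)
  𝓤col zero      = e₁
  𝓤col (ℕ.suc n) = 𝓡 (𝓤col n)

  𝓤φ : ℕ → ℕ → Carrier
  𝓤φ l j = 𝓤col (j ∸ 1) (l ∸ 1)

-- Binomial coefficient with integer lower index: C(n, k) = 0 for k < 0 (and for k > n via _C_).
binomℤ : ℕ → ℤ → ℤ
binomℤ n (+ k)      = + (n C k)
binomℤ n -[1+ _ ]   = + 0

coeffℤ : ℕ → ℕ → ℤ
coeffℤ m k = (ℤ.- ℤ.1ℤ) ℤ.^ k ℤ.* (binomℤ m (+ k) ℤ.- binomℤ m ((+ k) ℤ.- ℤ.1ℤ))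

module Submission where

-- Since F_{n+2} = X F_{n+1} + F_n, we have X F_i = F_{i+1} − F_{i−1} (with F_{−1} = 0): multiplying
-- by X acts on φ-Zeckendorf coordinates as 𝓡. Hence X^m has the coordinates 𝓡^m e₁, the m-th
-- column of 𝓤_φ, and these are the only ones because F_i has degree i and leading coefficient 1.
-- Over ℤ that column satisfies a(m+1, i+1) = a(m, i) − a(m, i+2); with i = m − 2k this is the
-- Pascal-type recursion of the ballot numbers (−1)^k (C(m,k) − C(m,k−1)), and the boundary row
-- i = 0 is handled by the symmetry C(2k+1, k+1) = C(2k+1, k). Everything is transported to k
-- along the ring morphism n ↦ n·1.

open import Defs
open import Level using (Level)
open import Algebra.Solver.Ring.AlmostCommutativeRing
  using (fromCommutativeRing; _-Raw-AlmostCommutative⟶_)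
import Algebra.Solver.Ring as RingSolver
import Algebra.Properties.Ring as RingProperties
import Algebra.Properties.CommutativeSemigroup as CommutativeSemigroupProperties
open import Data.Nat as ℕ using (ℕ; zero; suc; _≤_; _<_; _∸_)
import Data.Nat.Properties as ℕP
import Data.Nat.Tactic.RingSolver as ℕSolver
open import Data.Nat.Combinatorics using (_C_; nCk≡nC[n∸k]; nCk+nC[k+1]≡[n+1]C[k+1])
open import Data.Integer as ℤ using (ℤ; +_; -[1+_]; 0ℤ; 1ℤ; _⊖_)
import Data.Integer.Properties as ℤP
open import Data.Integer.Tactic.RingSolver using (solve-∀)
open import Data.Sign as Sign using ()
open import Data.Maybe using (Maybe; just; nothing)
open import Data.Product using (Σ; Σ-syntax; _×_; _,_)
open import Data.Sum using (_⊎_; inj₁; inj₂)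
open import Function using (_∘_)
open import Relation.Nullary using (yes; no; contradiction)
open import Relation.Binary.PropositionalEquality as ≡ using (_≡_; _≢_; cong; cong₂)

𝓤colℤ : ℕ → ℕ → ℤ
𝓤colℤ zero    zero    = 1ℤ
𝓤colℤ zero    (suc i) = 0ℤ
𝓤colℤ (suc m) zero    = ℤ.- 𝓤colℤ m 1
𝓤colℤ (suc m) (suc i) = 𝓤colℤ m i ℤ.- 𝓤colℤ m (suc (suc i))

binomℤ-pascal : ∀ m j → binomℤ (suc m) j ≡ binomℤ m (j ℤ.- 1ℤ) ℤ.+ binomℤ m j
binomℤ-pascal m (+ zero)  = ≡.refl
binomℤ-pascal m (+ suc k) = cong +_ (≡.sym (nCk+nC[k+1]≡[n+1]C[k+1] m k))
binomℤ-pascal m -[1+ _ ]  = ≡.refl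

coeffℤ-suc : ∀ m k → coeffℤ (suc m) (suc k) ≡ coeffℤ m (suc k) ℤ.- coeffℤ m k
coeffℤ-suc m k = begin
  ℤ.-1ℤ ℤ.* s ℤ.* (binomℤ (suc m) (+ suc k) ℤ.- binomℤ (suc m) (+ k))
    ≡⟨ cong₂ (λ a b → ℤ.-1ℤ ℤ.* s ℤ.* (a ℤ.- b))
             (binomℤ-pascal m (+ suc k)) (binomℤ-pascal m (+ k)) ⟩
  ℤ.-1ℤ ℤ.* s ℤ.* ((x ℤ.+ y) ℤ.- (w ℤ.+ x))
    ≡⟨ telescope s w x y ⟩
  ℤ.-1ℤ ℤ.* s ℤ.* (y ℤ.- x) ℤ.- s ℤ.* (x ℤ.- w)
    ∎
  where
  open ≡.≡-Reasoning
  s = (ℤ.- 1ℤ) ℤ.^ k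
  w = binomℤ m (+ k ℤ.- 1ℤ)
  x = binomℤ m (+ k)
  y = binomℤ m (+ suc k)
  telescope : ∀ s w x y → ℤ.-1ℤ ℤ.* s ℤ.* ((x ℤ.+ y) ℤ.- (w ℤ.+ x))
                          ≡ ℤ.-1ℤ ℤ.* s ℤ.* (y ℤ.- x) ℤ.- s ℤ.* (x ℤ.- w)
  telescope = solve-∀

coeffℤ-middle : ∀ k → coeffℤ (suc (k ℕ.+ k)) (suc k) ≡ 0ℤ
coeffℤ-middle k = begin
  s ℤ.* (+ (n C suc k) ℤ.- + (n C k))  ≡⟨ cong (λ t → s ℤ.* (+ t ℤ.- + (n C k))) symmetric ⟩
  s ℤ.* (+ (n C k) ℤ.- + (n C k))      ≡⟨ cong (s ℤ.*_) (ℤP.+-inverseʳ (+ (n C k))) ⟩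
  s ℤ.* 0ℤ                             ≡⟨ ℤP.*-zeroʳ s ⟩
  0ℤ                                   ∎
  where
  open ≡.≡-Reasoning
  n = suc (k ℕ.+ k)
  s = (ℤ.- 1ℤ) ℤ.^ suc k
  symmetric : n C suc k ≡ n C k
  symmetric = ≡.trans (nCk≡nC[n∸k] (ℕ.s≤s (ℕP.m≤n+m k k))) (cong (n C_) (ℕP.m+n∸n≡m k k))

𝓤colℤ-below-diagonal : ∀ m i → m < i → 𝓤colℤ m i ≡ 0ℤ
𝓤colℤ-below-diagonal zero    (suc i) _ = ≡.refl
𝓤colℤ-below-diagonal (suc m) (suc i) (ℕ.s≤s m<i)
  rewrite 𝓤colℤ-below-diagonal m i m<i
        | 𝓤colℤ-below-diagonal m (suc (suc i)) (ℕP.m<n⇒m<1+n (ℕP.m<n⇒m<1+n m<i))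
        = ≡.refl

i+[1+k+1+k]≡2+i+[k+k] : ∀ i k → i ℕ.+ (suc k ℕ.+ suc k) ≡ suc (suc i) ℕ.+ (k ℕ.+ k)
i+[1+k+1+k]≡2+i+[k+k] = ℕSolver.solve-∀

𝓤colℤ-odd : ∀ m i k → m ≡ suc (i ℕ.+ (k ℕ.+ k)) → 𝓤colℤ m i ≡ 0ℤ
𝓤colℤ-odd (suc m) zero zero ≡.refl = ≡.refl
𝓤colℤ-odd (suc m) zero (suc k) ≡.refl
  rewrite 𝓤colℤ-odd m 1 k (cong suc (ℕP.+-suc k k)) = ≡.refl
𝓤colℤ-odd (suc m) (suc i) zero ≡.refl
  rewrite 𝓤colℤ-odd m i zero ≡.refl
        | 𝓤colℤ-below-diagonal m (suc (suc i)) (ℕ.s≤s (ℕ.s≤s (ℕP.≤-reflexive (ℕP.+-identityʳ i))))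
        = ≡.refl
𝓤colℤ-odd (suc m) (suc i) (suc k) ≡.refl
  rewrite 𝓤colℤ-odd m i (suc k) ≡.refl
        | 𝓤colℤ-odd m (suc (suc i)) k (cong suc (i+[1+k+1+k]≡2+i+[k+k] i k)) = ≡.refl

𝓤colℤ-even : ∀ m i k → m ≡ i ℕ.+ (k ℕ.+ k) → 𝓤colℤ m i ≡ coeffℤ m k
𝓤colℤ-even zero    zero    zero    ≡.refl = ≡.refl
𝓤colℤ-even (suc m) zero    (suc k) eq     = begin
  ℤ.- 𝓤colℤ m 1                   ≡⟨ cong ℤ.-_ (𝓤colℤ-even m 1 k m≡1+2k) ⟩
  ℤ.- coeffℤ m k                  ≡⟨ ℤP.+-identityˡ (ℤ.- coeffℤ m k) ⟨
  0ℤ ℤ.- coeffℤ m k               ≡⟨ cong (ℤ._- coeffℤ m k) middle ⟨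
  coeffℤ m (suc k) ℤ.- coeffℤ m k ≡⟨ coeffℤ-suc m k ⟨
  coeffℤ (suc m) (suc k)          ∎
  where
  open ≡.≡-Reasoning
  m≡1+2k : m ≡ suc (k ℕ.+ k)
  m≡1+2k = ≡.trans (ℕP.suc-injective eq) (ℕP.+-suc k k)
  middle : coeffℤ m (suc k) ≡ 0ℤ
  middle = ≡.trans (cong (λ n → coeffℤ n (suc k)) m≡1+2k) (coeffℤ-middle k)
𝓤colℤ-even (suc m) (suc i) zero    ≡.refl
  rewrite 𝓤colℤ-even m i zero ≡.refl
        | 𝓤colℤ-below-diagonal m (suc (suc i)) (ℕ.s≤s (ℕP.m≤n⇒m≤1+n (ℕP.≤-reflexive (ℕP.+-identityʳ i))))
        = ≡.refl
𝓤colℤ-even (suc m) (suc i) (suc k) ≡.refl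
  rewrite 𝓤colℤ-even m i (suc k) ≡.refl
        | 𝓤colℤ-even m (suc (suc i)) k (i+[1+k+1+k]≡2+i+[k+k] i k) = ≡.sym (coeffℤ-suc m k)

even⊎odd : ∀ n → (Σ[ k ∈ ℕ ] n ≡ k ℕ.+ k) ⊎ (Σ[ k ∈ ℕ ] n ≡ suc (k ℕ.+ k))
even⊎odd zero    = inj₁ (0 , ≡.refl)
even⊎odd (suc n) with even⊎odd n
... | inj₁ (k , n≡2k)   = inj₂ (k , cong suc n≡2k)
... | inj₂ (k , n≡2k+1) = inj₁ (suc k , cong suc (≡.trans n≡2k+1 (≡.sym (ℕP.+-suc k k))))

2*k≡k+k : ∀ k → 2 ℕ.* k ≡ k ℕ.+ k
2*k≡k+k k = cong (k ℕ.+_) (ℕP.+-identityʳ k)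

𝓤colℤ-off-parity : ∀ m i → (∀ k → m ≢ i ℕ.+ 2 ℕ.* k) → 𝓤colℤ m i ≡ 0ℤ
𝓤colℤ-off-parity m i m≢i+2k with i ℕP.≤? m
... | no  i≰m = 𝓤colℤ-below-diagonal m i (ℕP.≰⇒> i≰m)
... | yes i≤m with even⊎odd (m ∸ i) | ℕP.m+[n∸m]≡n i≤m
...   | inj₁ (k , d≡2k)   | i+d≡m =
  contradiction (≡.trans (≡.sym i+d≡m) (cong (i ℕ.+_) (≡.trans d≡2k (≡.sym (2*k≡k+k k))))) (m≢i+2k k)
...   | inj₂ (k , d≡2k+1) | i+d≡m =
  𝓤colℤ-odd m i k (≡.trans (≡.sym i+d≡m) (≡.trans (cong (i ℕ.+_) d≡2k+1) (ℕP.+-suc i _)))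

module _ {c ℓ : Level} (K : Field c ℓ) where
  open Field K
  open RingProperties ring
  open CommutativeSemigroupProperties +-commutativeSemigroup using (interchange)
  open import Relation.Binary.Reasoning.Setoid setoid

  ℕ·1-homo-+ : ∀ m n → ℕ·1 K (m ℕ.+ n) ≈ ℕ·1 K m + ℕ·1 K n
  ℕ·1-homo-+ zero    n = sym (+-identityˡ _)
  ℕ·1-homo-+ (suc m) n = trans (+-congˡ (ℕ·1-homo-+ m n)) (sym (+-assoc _ _ _))

  ℤ·1-homo-⊖ : ∀ m n → ℤ·1 K (m ⊖ n) ≈ ℕ·1 K m - ℕ·1 K n
  ℤ·1-homo-⊖ m       zero    rewrite ℤP.⊖-≥ (ℕ.z≤n {m}) = sym (trans (+-congˡ -0#≈0#) (+-identityʳ _))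
  ℤ·1-homo-⊖ zero    (suc n) = sym (+-identityˡ _)
  ℤ·1-homo-⊖ (suc m) (suc n) rewrite ℤP.[1+m]⊖[1+n]≡m⊖n m n = begin
    ℤ·1 K (m ⊖ n)                     ≈⟨ ℤ·1-homo-⊖ m n ⟩
    ℕ·1 K m - ℕ·1 K n                 ≈⟨ cancel-1# ⟨
    (1# + ℕ·1 K m) - (1# + ℕ·1 K n)   ∎
    where
    cancel-1# : (1# + ℕ·1 K m) - (1# + ℕ·1 K n) ≈ ℕ·1 K m - ℕ·1 K n
    cancel-1# = begin
      (1# + ℕ·1 K m) + - (1# + ℕ·1 K n)     ≈⟨ +-congˡ (-‿+-comm 1# _) ⟨
      (1# + ℕ·1 K m) + (- 1# + - ℕ·1 K n)   ≈⟨ interchange 1# _ (- 1#) _ ⟩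
      (1# - 1#) + (ℕ·1 K m - ℕ·1 K n)       ≈⟨ +-congʳ (-‿inverseʳ 1#) ⟩
      0# + (ℕ·1 K m - ℕ·1 K n)              ≈⟨ +-identityˡ _ ⟩
      ℕ·1 K m - ℕ·1 K n                     ∎

  ℤ·1-homo-neg : ∀ a → ℤ·1 K (ℤ.- a) ≈ - ℤ·1 K a
  ℤ·1-homo-neg (+ zero)  = sym -0#≈0#
  ℤ·1-homo-neg (+ suc n) = refl
  ℤ·1-homo-neg -[1+ n ]  = sym (-‿involutive _)

  ℤ·1-homo-+ : ∀ a b → ℤ·1 K (a ℤ.+ b) ≈ ℤ·1 K a + ℤ·1 K b
  ℤ·1-homo-+ (+ m)    (+ n)    = ℕ·1-homo-+ m n
  ℤ·1-homo-+ (+ m)    -[1+ n ] = ℤ·1-homo-⊖ m (suc n)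
  ℤ·1-homo-+ -[1+ m ] (+ n)    = trans (ℤ·1-homo-⊖ n (suc m)) (+-comm _ _)
  ℤ·1-homo-+ -[1+ m ] -[1+ n ] = begin
    - ℕ·1 K (suc (suc (m ℕ.+ n)))          ≡⟨ cong (λ t → - ℕ·1 K (suc t)) (ℕP.+-suc m n) ⟨
    - ℕ·1 K (suc m ℕ.+ suc n)              ≈⟨ -‿cong (ℕ·1-homo-+ (suc m) (suc n)) ⟩
    - (ℕ·1 K (suc m) + ℕ·1 K (suc n))      ≈⟨ -‿+-comm _ _ ⟨
    - ℕ·1 K (suc m) + - ℕ·1 K (suc n)      ∎

  ℤ·1-homo-− : ∀ a b → ℤ·1 K (a ℤ.- b) ≈ ℤ·1 K a - ℤ·1 K b
  ℤ·1-homo-− a b = trans (ℤ·1-homo-+ a (ℤ.- b)) (+-congˡ (ℤ·1-homo-neg b))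

  ℕ·1-homo-* : ∀ m n → ℕ·1 K (m ℕ.* n) ≈ ℕ·1 K m * ℕ·1 K n
  ℕ·1-homo-* zero    n = sym (zeroˡ _)
  ℕ·1-homo-* (suc m) n = begin
    ℕ·1 K (n ℕ.+ m ℕ.* n)                   ≈⟨ ℕ·1-homo-+ n (m ℕ.* n) ⟩
    ℕ·1 K n + ℕ·1 K (m ℕ.* n)               ≈⟨ +-cong (sym (*-identityˡ _)) (ℕ·1-homo-* m n) ⟩
    1# * ℕ·1 K n + ℕ·1 K m * ℕ·1 K n        ≈⟨ distribʳ _ _ _ ⟨
    (1# + ℕ·1 K m) * ℕ·1 K n                ∎

  ℤ·1-+◃ : ∀ n → ℤ·1 K (Sign.+ ℤ.◃ n) ≈ ℕ·1 K n
  ℤ·1-+◃ zero    = refl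
  ℤ·1-+◃ (suc n) = refl

  ℤ·1-−◃ : ∀ n → ℤ·1 K (Sign.- ℤ.◃ n) ≈ - ℕ·1 K n
  ℤ·1-−◃ zero    = sym -0#≈0#
  ℤ·1-−◃ (suc n) = refl

  ℤ·1-homo-* : ∀ a b → ℤ·1 K (a ℤ.* b) ≈ ℤ·1 K a * ℤ·1 K b
  ℤ·1-homo-* (+ m)    (+ n)    = trans (ℤ·1-+◃ (m ℕ.* n)) (ℕ·1-homo-* m n)
  ℤ·1-homo-* (+ m)    -[1+ n ] =
    trans (ℤ·1-−◃ (m ℕ.* suc n)) (trans (-‿cong (ℕ·1-homo-* m (suc n))) (-‿distribʳ-* _ _))
  ℤ·1-homo-* -[1+ m ] (+ n)    =
    trans (ℤ·1-−◃ (suc m ℕ.* n)) (trans (-‿cong (ℕ·1-homo-* (suc m) n)) (-‿distribˡ-* _ _))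
  ℤ·1-homo-* -[1+ m ] -[1+ n ] = begin
    ℤ·1 K (Sign.+ ℤ.◃ (suc m ℕ.* suc n))    ≈⟨ ℤ·1-+◃ (suc m ℕ.* suc n) ⟩
    ℕ·1 K (suc m ℕ.* suc n)                 ≈⟨ ℕ·1-homo-* (suc m) (suc n) ⟩
    ℕ·1 K (suc m) * ℕ·1 K (suc n)           ≈⟨ -‿involutive _ ⟨
    - - (ℕ·1 K (suc m) * ℕ·1 K (suc n))     ≈⟨ -‿cong (-‿distribˡ-* _ _) ⟩
    - (- ℕ·1 K (suc m) * ℕ·1 K (suc n))     ≈⟨ -‿distribʳ-* _ _ ⟩
    - ℕ·1 K (suc m) * - ℕ·1 K (suc n)       ∎

  ℤ·1-morphism : ℤ.+-*-rawRing -Raw-AlmostCommutative⟶ fromCommutativeRing commutativeRing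
  ℤ·1-morphism = record
    { ⟦_⟧ = ℤ·1 K ; +-homo = ℤ·1-homo-+ ; *-homo = ℤ·1-homo-* ; -‿homo = ℤ·1-homo-neg
    ; 0-homo = refl ; 1-homo = +-identityʳ 1# }

  ℤ·1-≈? : ∀ a b → Maybe (ℤ·1 K a ≈ ℤ·1 K b)
  ℤ·1-≈? a b with a ℤ.≟ b
  ... | yes ≡.refl = just refl
  ... | no _       = nothing

  -- The solver only cancels coefficients whose equality it can decide, so it runs with
  -- coefficients in ℤ acting through ℤ·1 rather than with coefficients in k itself.
  open RingSolver ℤ.+-*-rawRing (fromCommutativeRing commutativeRing) ℤ·1-morphism ℤ·1-≈?

  Fib-vanishes-above : ∀ n d → n < d → Fib K n d ≈ 0#
  Fib-vanishes-above zero          (suc d)       _           = refl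
  Fib-vanishes-above (suc zero)    (suc (suc d)) _           = +-identityˡ _
  Fib-vanishes-above (suc zero)    (suc zero)    (ℕ.s≤s ())
  Fib-vanishes-above (suc (suc n)) (suc d)       (ℕ.s≤s n<d) =
    trans (+-cong (Fib-vanishes-above (suc n) d n<d)
                  (Fib-vanishes-above n (suc d) (ℕP.m<n⇒m<1+n (ℕP.<-trans (ℕP.n<1+n n) n<d))))
          (+-identityˡ _)

  Fib-leading : ∀ n → Fib K n n ≈ 1#
  Fib-leading zero          = refl
  Fib-leading (suc zero)    = +-identityʳ _
  Fib-leading (suc (suc n)) =
    trans (+-cong (Fib-leading (suc n)) (Fib-vanishes-above n (suc (suc n)) (ℕP.m<n⇒m<1+n (ℕP.n<1+n n))))
          (+-identityʳ _)

  ΣF-vanishes-above : ∀ m z d → m < d → ΣF K m z d ≈ 0#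
  ΣF-vanishes-above zero    z d m<d = trans (*-congˡ (Fib-vanishes-above 0 d m<d)) (zeroʳ _)
  ΣF-vanishes-above (suc m) z d m<d =
    trans (+-cong (ΣF-vanishes-above m z d (ℕP.<-trans (ℕP.n<1+n m) m<d))
                  (trans (*-congˡ (Fib-vanishes-above (suc m) d m<d)) (zeroʳ _)))
          (+-identityʳ _)

  ΣF-leading : ∀ m z → ΣF K m z m ≈ z m
  ΣF-leading zero    z = *-identityʳ _
  ΣF-leading (suc m) z =
    trans (+-cong (ΣF-vanishes-above m z (suc m) (ℕP.n<1+n m))
                  (trans (*-congˡ (Fib-leading (suc m))) (*-identityʳ _)))
          (+-identityˡ _)

  ΣF-leading-unique : ∀ m z u → (∀ d → ΣF K m z d ≈ ΣF K m u d) → z m ≈ u m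
  ΣF-leading-unique m z u z≈u = trans (sym (ΣF-leading m z)) (trans (z≈u m) (ΣF-leading m u))

  ΣF-injective : ∀ m z u → (∀ d → ΣF K m z d ≈ ΣF K m u d) → ∀ i → i ≤ m → z i ≈ u i
  ΣF-injective m z u z≈u i i≤m with ℕP.m≤n⇒m<n∨m≡n i≤m
  ... | inj₂ ≡.refl = ΣF-leading-unique m z u z≈u
  ΣF-injective (suc m) z u z≈u i _ | inj₁ (ℕ.s≤s i≤m) = ΣF-injective m z u lower i i≤m
    where
    lower : ∀ d → ΣF K m z d ≈ ΣF K m u d
    lower d = +-cancelʳ _ _ _ (trans (z≈u d) (+-congˡ (*-congʳ (sym (ΣF-leading-unique (suc m) z u z≈u)))))

  Xₚ*-+ : ∀ P Q d → Xₚ* K (_+ₚ_ K P Q) d ≈ Xₚ* K P d + Xₚ* K Q d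
  Xₚ*-+ P Q zero    = sym (+-identityˡ 0#)
  Xₚ*-+ P Q (suc d) = refl

  Xₚ*-· : ∀ a P d → Xₚ* K (_·ₚ_ K a P) d ≈ a * Xₚ* K P d
  Xₚ*-· a P zero    = sym (zeroʳ a)
  Xₚ*-· a P (suc d) = refl

  Xₚ*-cong : ∀ P Q → (∀ d → P d ≈ Q d) → ∀ d → Xₚ* K P d ≈ Xₚ* K Q d
  Xₚ*-cong P Q P≈Q zero    = refl
  Xₚ*-cong P Q P≈Q (suc d) = P≈Q d

  Xₚ*-Fib-zero : ∀ d → Xₚ* K (Fib K 0) d ≈ Fib K 1 d
  Xₚ*-Fib-zero d = sym (+-identityʳ _)

  -- When z vanishes beyond n the two correction terms drop out: X acts on coordinates as 𝓡.
  Xₚ*-ΣF : ∀ n z d → Xₚ* K (ΣF K n z) d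
                     ≈ ΣF K (suc n) (𝓡 K z) d + z (suc n) * Fib K n d + z (suc (suc n)) * Fib K (suc n) d
  Xₚ*-ΣF zero z d = begin
    Xₚ* K (ΣF K 0 z) d
      ≈⟨ trans (Xₚ*-· (z 0) (Fib K 0) d) (*-congˡ (Xₚ*-Fib-zero d)) ⟩
    z 0 * F₁
      ≈⟨ solve 5 (λ z₀ z₁ z₂ f₀ f₁ → z₀ :* f₁ := (:- z₁) :* f₀ :+ (z₀ :- z₂) :* f₁ :+ z₁ :* f₀ :+ z₂ :* f₁)
               refl (z 0) (z 1) (z 2) F₀ F₁ ⟩
    - z 1 * F₀ + (z 0 - z 2) * F₁ + z 1 * F₀ + z 2 * F₁
      ∎
    where
    F₀ = Fib K 0 d
    F₁ = Fib K 1 d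
  Xₚ*-ΣF (suc n) z d = begin
    Xₚ* K (ΣF K (suc n) z) d
      ≈⟨ trans (Xₚ*-+ (ΣF K n z) _ d) (+-congˡ (Xₚ*-· (z (suc n)) (Fib K (suc n)) d)) ⟩
    Xₚ* K (ΣF K n z) d + z (suc n) * XF
      ≈⟨ +-congʳ (Xₚ*-ΣF n z d) ⟩
    T + z (suc n) * F₀ + z (suc (suc n)) * F₁ + z (suc n) * XF
      ≈⟨ solve 7 (λ t z₁ z₂ z₃ f₀ f₁ xf →
                    t :+ z₁ :* f₀ :+ z₂ :* f₁ :+ z₁ :* xf
                 := t :+ (z₁ :- z₃) :* (xf :+ f₀) :+ z₂ :* f₁ :+ z₃ :* (xf :+ f₀))
               refl T (z (suc n)) (z (suc (suc n))) (z (suc (suc (suc n)))) F₀ F₁ XF ⟩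
    T + (z (suc n) - z (suc (suc (suc n)))) * F₂ + z (suc (suc n)) * F₁ + z (suc (suc (suc n))) * F₂
      ∎
    where
    T  = ΣF K (suc n) (𝓡 K z) d
    F₀ = Fib K n d
    F₁ = Fib K (suc n) d
    F₂ = Fib K (suc (suc n)) d
    XF = Xₚ* K (Fib K (suc n)) d

  𝓤col≈ℤ·1𝓤colℤ : ∀ m i → 𝓤col K m i ≈ ℤ·1 K (𝓤colℤ m i)
  𝓤col≈ℤ·1𝓤colℤ zero    zero    = sym (+-identityʳ 1#)
  𝓤col≈ℤ·1𝓤colℤ zero    (suc i) = refl
  𝓤col≈ℤ·1𝓤colℤ (suc m) zero    = trans (-‿cong (𝓤col≈ℤ·1𝓤colℤ m 1)) (sym (ℤ·1-homo-neg (𝓤colℤ m 1)))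
  𝓤col≈ℤ·1𝓤colℤ (suc m) (suc i) =
    trans (+-cong (𝓤col≈ℤ·1𝓤colℤ m i) (-‿cong (𝓤col≈ℤ·1𝓤colℤ m (suc (suc i)))))
          (sym (ℤ·1-homo-− (𝓤colℤ m i) (𝓤colℤ m (suc (suc i)))))

  𝓤col-below-diagonal : ∀ m i → m < i → 𝓤col K m i ≈ 0#
  𝓤col-below-diagonal m i m<i =
    trans (𝓤col≈ℤ·1𝓤colℤ m i) (reflexive (cong (ℤ·1 K) (𝓤colℤ-below-diagonal m i m<i)))

  𝓤col-on-parity : ∀ m i k → m ≡ i ℕ.+ 2 ℕ.* k → 𝓤col K m i ≈ ℤ·1 K (coeffℤ m k)
  𝓤col-on-parity m i k m≡i+2k = trans (𝓤col≈ℤ·1𝓤colℤ m i)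
    (reflexive (cong (ℤ·1 K) (𝓤colℤ-even m i k (≡.trans m≡i+2k (cong (i ℕ.+_) (2*k≡k+k k))))))

  𝓤col-off-parity : ∀ m i → (∀ k → m ≢ i ℕ.+ 2 ℕ.* k) → 𝓤col K m i ≈ 0#
  𝓤col-off-parity m i m≢i+2k =
    trans (𝓤col≈ℤ·1𝓤colℤ m i) (reflexive (cong (ℤ·1 K) (𝓤colℤ-off-parity m i m≢i+2k)))

  Xpow≈ΣF𝓤col : ∀ m d → Xpow K m d ≈ ΣF K m (𝓤col K m) d
  Xpow≈ΣF𝓤col zero    d = sym (*-identityˡ _)
  Xpow≈ΣF𝓤col (suc m) d = begin
    Xₚ* K (Xpow K m) d                     ≈⟨ Xₚ*-cong _ _ (Xpow≈ΣF𝓤col m) d ⟩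
    Xₚ* K (ΣF K m (𝓤col K m)) d            ≈⟨ Xₚ*-ΣF m (𝓤col K m) d ⟩
    T + u (suc m) * Fib K m d + u (suc (suc m)) * Fib K (suc m) d
      ≈⟨ +-cong (+-congˡ (vanish (suc m) _ (ℕP.n<1+n m)))
                (vanish (suc (suc m)) _ (ℕP.m<n⇒m<1+n (ℕP.n<1+n m))) ⟩
    T + 0# + 0#                            ≈⟨ trans (+-identityʳ _) (+-identityʳ _) ⟩
    T                                      ∎
    where
    u = 𝓤col K m
    T = ΣF K (suc m) (𝓤col K (suc m)) d
    vanish : ∀ i x → m < i → u i * x ≈ 0#
    vanish i x m<i = trans (*-congʳ (𝓤col-below-diagonal m i m<i)) (zeroˡ x)

  IsZeckRep-Xpow⇒≈𝓤col : ∀ m z → IsZeckRep K m (Xpow K m) z → ∀ i → i ≤ m → z i ≈ 𝓤col K m i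
  IsZeckRep-Xpow⇒≈𝓤col m z rep =
    ΣF-injective m z (𝓤col K m) (λ d → trans (sym (rep d)) (Xpow≈ΣF𝓤col m d))

  IsZeckRep-Xpow-on-parity : ∀ m z → IsZeckRep K m (Xpow K m) z →
                             ∀ k → 2 ℕ.* k ≤ m → z (m ∸ 2 ℕ.* k) ≈ ℤ·1 K (coeffℤ m k)
  IsZeckRep-Xpow-on-parity m z rep k 2k≤m =
    trans (IsZeckRep-Xpow⇒≈𝓤col m z rep _ (ℕP.m∸n≤m m (2 ℕ.* k)))
          (𝓤col-on-parity m (m ∸ 2 ℕ.* k) k (≡.sym (ℕP.m∸n+n≡m 2k≤m)))

  IsZeckRep-Xpow-off-parity : ∀ m z → IsZeckRep K m (Xpow K m) z →
                              ∀ i → i ≤ m → (∀ k → m ≢ i ℕ.+ 2 ℕ.* k) → z i ≈ 0#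
  IsZeckRep-Xpow-off-parity m z rep i i≤m m≢i+2k =
    trans (IsZeckRep-Xpow⇒≈𝓤col m z rep i i≤m) (𝓤col-off-parity m i m≢i+2k)

≢∸2*⇒≢+2* : ∀ {m i} → i ≢ m → (∀ k → 1 ≤ k → 2 ℕ.* k ≤ m → i ≢ m ∸ 2 ℕ.* k) →
            ∀ k → m ≢ i ℕ.+ 2 ℕ.* k
≢∸2*⇒≢+2* {i = i} i≢m _     zero    m≡i+0  = i≢m (≡.sym (≡.trans m≡i+0 (ℕP.+-identityʳ i)))
≢∸2*⇒≢+2* {m} {i} _   avoid (suc k) m≡i+2k =
  avoid (suc k) (ℕ.s≤s ℕ.z≤n) (≡.subst (2 ℕ.* suc k ≤_) (≡.sym m≡i+2k) (ℕP.m≤n+m _ i))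
        (≡.sym (≡.trans (cong (_∸ 2 ℕ.* suc k) m≡i+2k) (ℕP.m+n∸n≡m i (2 ℕ.* suc k))))

lemma4 : ∀ {c ℓ : Level} (K : Field c ℓ) →
    let open Field K in
    ((m : ℕ) → Σ (ℕ → Carrier) (λ z → IsZeckRep K m (Xpow K m) z))
    ×
    ((m : ℕ) (z : ℕ → Carrier) → IsZeckRep K m (Xpow K m) z →
        (z m ≈ 1#)
      × ((k : ℕ) → 1 ≤ k → 2 ℕ.* k ≤ m → z (m ∸ 2 ℕ.* k) ≈ ℤ·1 K (coeffℤ m k))
      × ((i : ℕ) → i ≤ m → i ≢ m → ((k : ℕ) → 1 ≤ k → 2 ℕ.* k ≤ m → i ≢ m ∸ 2 ℕ.* k) → z i ≈ 0#))
    ×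
    ((l j k : ℕ) → 1 ≤ l → 1 ≤ j → j ≡ l ℕ.+ 2 ℕ.* k → 𝓤φ K l j ≈ ℤ·1 K (coeffℤ (j ∸ 1) k))
    ×
    ((l j : ℕ) → 1 ≤ l → 1 ≤ j → ((k : ℕ) → j ≢ l ℕ.+ 2 ℕ.* k) → 𝓤φ K l j ≈ 0#)
lemma4 K =
    (λ m → 𝓤col K m , Xpow≈ΣF𝓤col K m)
  , (λ m z rep → trans (IsZeckRep-Xpow-on-parity K m z rep 0 ℕ.z≤n) (+-identityʳ 1#)
               , (λ k _ → IsZeckRep-Xpow-on-parity K m z rep k)
               , (λ i i≤m i≢m avoid → IsZeckRep-Xpow-off-parity K m z rep i i≤m (≢∸2*⇒≢+2* i≢m avoid)))
  , (λ { (suc l) (suc j) k _ _ j≡l+2k → 𝓤col-on-parity K j l k (ℕP.suc-injective j≡l+2k) })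
  , (λ { (suc l) (suc j) _ _ j≢l+2k → 𝓤col-off-parity K j l (λ k → j≢l+2k k ∘ cong suc) })
  where open Field K
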